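{- Let $K\ge1$, let $G=(V,E)$ be a $K$-edge-connected graph with a cactus representation $(\mathfrak C_G,\phi)$ such that $|\phi^{ -1}(b)|\le1$ for every node $b$, and fix a root vertex $r$ of degree $K$. Let $b\neq\phi(r)$ be an external node of $\mathfrak C_G$ with $\phi^{ -1}(b)=\{v\}$. Then $\widetilde H(W^b)=\{v\}\cup N(v)$.
   Context: For $\emptyset\neq X\subsetneq V$, $\delta(X)$ is the set of edges of $G$ with exactly one endpoint in $X$; it is a $K$-cut if $|\delta(X)|=K$; for an edge set $F$, $V(F)$ is the set of endpoints of edges of $F$; $N(v)$ is the set of neighbours of $v$. $G$ is $K$-edge-connected if connected and stays connected after deleting any $K-1$ edges. A cactus is a connected multigraph (nodes and links) in which every link lies on exactly one cycle (length-$2$ cycles allowed); a node of degree $2$ is external. A cactus representation of $G$ is a cactus $\mathfrak C_G$ with a map $\phi:V\to$ nodes such that for every $X\subseteq V$, $\delta(X)$ is a $K$-cut iff $X=\phi^{ -1}(Q)$ for a node set $Q$ joined to its complement by exactly two links. Root $\mathfrak C_G$ at $\phi(r)$; a node $a$ is below a node $b$ if $b$ lies on every path from $a$ to $\phi(r)$; $Q^b$ is the set consisting of $b$ and all nodes below $b$, and $W^b=\phi^{ -1}(Q^b)$. A tree in $G$ is a subgraph that is a tree; for a tree $T$, vertex $w\in T$ and edge $e\in T$, $T^w_{\mathrm{out}}(e)$ is the vertex set of the component of $T-e$ not containing $w$; $(T,w)$ is safe if $|\delta(T^w_{\mathrm{out}}(e))|=K$ for every edge $e$ of $T$. For a set $Z$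 of vertices with $\delta(Z)$ a $K$-cut, a vertex $w\in V(\delta(Z))$ is a hub for $Z$ if there is a spanning tree $T$ of the subgraph of $G$ induced by $Z\cup\{w\}$ such that $(T,w)$ is safe; $\widetilde H(Z)$ is the set of hubs for $Z$. -}

module Defs where

open import Data.Nat using (ℕ; zero; suc; _+_; _<_; _≤_)
open import Data.Bool using (Bool; true; false; if_then_else_; _xor_; _∧_; _∨_)
open import Data.Fin using (Fin; zero; suc; _≟_)
open import Data.Fin.Subset using (Subset; _∈_; _∉_; _⊆_; ∁; _∪_; _-_; ⁅_⁆; ∣_∣; Nonempty)
open import Data.Vec using (lookup; tabulate)
open import Data.Product using (Σ; ∃; _×_; _,_; proj₁; proj₂)
open import Data.Sum using (_⊎_)
open import Relation.Nullary using (¬_)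
open import Relation.Nullary.Decidable using (⌊_⌋)
open import Relation.Binary.PropositionalEquality using (_≡_; _≢_)
open import Function using (_∘_)
open import Function.Bundles using (_⇔_)

-- Finite multigraphs: vertices Fin n, edges Fin m, each edge e has the
-- (unordered) pair of endpoints  ends e.  Parallel edges are allowed.

Ends : ℕ → ℕ → Set
Ends n m = Fin m → Fin n × Fin n

module _ {n m : ℕ} (ends : Ends n m) where

  countTrue : ∀ {k} → (Fin k → Bool) → ℕ
  countTrue {zero}  f = 0
  countTrue {suc k} f = (if f zero then 1 else 0) + countTrue (f ∘ suc)

  memb : Subset n → Fin n → Bool
  memb X x = lookup X x

  crosses : Subset n → Fin m → Bool
  crosses X e = memb X (proj₁ (ends e)) xor memb X (proj₂ (ends e))

  cutSize : Subset n → ℕ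
  cutSize X = countTrue (crosses X)

  IncidentTo : Fin m → Fin n → Set
  IncidentTo e v = (proj₁ (ends e) ≡ v) ⊎ (proj₂ (ends e) ≡ v)

  -- number of edge-ends of edges in C at v (a loop would count twice)
  degIn : Subset m → Fin n → ℕ
  degIn C v = countTrue (λ e → lookup C e ∧ ⌊ proj₁ (ends e) ≟ v ⌋)
            + countTrue (λ e → lookup C e ∧ ⌊ proj₂ (ends e) ≟ v ⌋)

  deg : Fin n → ℕ
  deg v = degIn (tabulate (λ _ → true)) v

  Loopless : Set
  Loopless = ∀ e → proj₁ (ends e) ≢ proj₂ (ends e)

  Adjacent : Fin n → Fin n → Set
  Adjacent u w = ∃ λ e → (ends e ≡ (u , w)) ⊎ (ends e ≡ (w , u))

  Joins : Fin m → Fin n → Fin n → Set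
  Joins e x y = (ends e ≡ (x , y)) ⊎ (ends e ≡ (y , x))

  data Walk (S : Subset m) : Fin n → Fin n → Set where
    stop : ∀ {x} → Walk S x x
    step : ∀ {x y z} (e : Fin m) → e ∈ S → Joins e x y → Walk S y z → Walk S x z

  visits : ∀ {S x z} → Walk S x z → Fin n → Set
  visits {x = x} stop         u = x ≡ u
  visits {x = x} (step _ _ _ w) u = (x ≡ u) ⊎ visits w u

  allEdges : Subset m
  allEdges = tabulate (λ _ → true)

  Connected : Set
  Connected = ∀ x y → Walk allEdges x y

  KEdgeConnected : ℕ → Set
  KEdgeConnected K = Connected × (∀ (D : Subset m) → ∣ D ∣ < K → ∀ x y → Walk (∁ D) x y)

  Touches : Subset m → Fin n → Set
  Touches C v = ∃ λ e → e ∈ C × IncidentTo e v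

  IsCycle : Subset m → Set
  IsCycle C = Nonempty C
            × (∀ x y → Touches C x → Touches C y → Walk C x y)
            × (∀ v → Touches C v → degIn C v ≡ 2)

  IsCactus : Set
  IsCactus = Connected × Loopless
           × (∀ (l : Fin m) → (∃ λ C → IsCycle C × l ∈ C)
                            × (∀ C C′ → IsCycle C → l ∈ C → IsCycle C′ → l ∈ C′ → C ≡ C′))

  SpanningTreeOf : Subset n → Subset m → Set
  SpanningTreeOf U T =
      (∀ e → e ∈ T → proj₁ (ends e) ∈ U × proj₂ (ends e) ∈ U)
    × (∀ x y → x ∈ U → y ∈ U → Walk T x y)
    × (∀ C → C ⊆ T → ¬ IsCycle C)

  IsOutSet : Subset n → Subset m → Fin n → Fin m → Subset n → Set
  IsOutSet U T w e O = ∀ x → (x ∈ O) ⇔ (x ∈ U × ¬ Walk (T - e) w x)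

  Safe : ℕ → Subset n → Subset m → Fin n → Set
  Safe K U T w = ∀ e → e ∈ T → ∃ λ O → IsOutSet U T w e O × cutSize O ≡ K

  Hub : ℕ → Subset n → Fin n → Set
  Hub K Z w = (∃ λ e → crosses Z e ≡ true × IncidentTo e w)
            × (∃ λ T → SpanningTreeOf (Z ∪ ⁅ w ⁆) T × Safe K (Z ∪ ⁅ w ⁆) T w)

preimage : ∀ {n c} → (Fin n → Fin c) → Subset c → Subset n
preimage φ Q = tabulate (λ x → lookup Q (φ x))

IsCactusRep : ∀ {n m c l} → Ends n m → ℕ → Ends c l → (Fin n → Fin c) → Set
IsCactusRep ends K links φ =
  IsCactus links ×
  (∀ (X : Subset _) → (cutSize ends X ≡ K) ⇔ (∃ λ Q → cutSize links Q ≡ 2 × X ≡ preimage φ Q))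

Below : ∀ {c l} → Ends c l → Fin c → Fin c → Fin c → Set
Below links ρ a b = ∀ (p : Walk links (allEdges links) a ρ) → visits links p b

module Submission where

-- A cactus has no 1-cut: the crossing link lies on a cycle, and a cycle crosses
-- every vertex set Q an even number of times, since summing its degrees over Q
-- counts each inner edge twice and each crossing edge once.  If a node a ≠ b
-- lay below the external node b, the set Q of nodes reaching the root without
-- passing b would satisfy |δ(Q)| + |δ(Q ∪ {b})| = deg b = 2 with both terms
-- positive, a 1-cut.  Hence W = φ⁻¹(b) = {v}, and δ({v}) is a K-cut because
-- δ({b}) is a 2-cut of the cactus.  The hubs of a singleton {v} are v itself
-- (with the empty tree) and its neighbours w (with the tree consisting of one
-- edge vw, whose only out-set is {v}).

open import Data.Bool using (Bool; true; false; if_then_else_; _xor_; _∧_; _∨_)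
open import Data.Bool.Properties using (∨-identityʳ; xor-same)
open import Data.Empty using (⊥; ⊥-elim)
open import Data.Fin using (Fin; zero; suc; _≟_)
open import Data.Fin.Properties using (suc-injective; sequence)
open import Data.Fin.Subset using (Subset; ∣_∣; _∈_; _∉_; _∪_; ⁅_⁆; _⊆_; _─_; _-_) renaming (⊥ to ∅)
open import Data.Fin.Subset.Properties using (x∈⁅x⁆; x∈⁅y⁆⇒x≡y; ∪-identityˡ; x∈p∪q⁺; x∈p∪q⁻; ∉⊥; ⊆-antisym)
open import Data.Nat using (ℕ; zero; suc; _+_; _*_; _≤_; _≥_; z≤n; s≤s)
open import Data.Nat.Divisibility using (_∣_; ∣-reflexive; ∣m∣n⇒∣m+n; ∣m+n∣m⇒∣n; ∣m⇒∣m*n; m∣m*n; _∣0; ∣1⇒≡1)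
import Data.Nat.Properties as ℕ
open import Data.Nat.Properties using (+-identityʳ; *-assoc; *-distribʳ-+; ≤-trans; ≤-reflexive; m≤n+m; ≤-antisym)
open import Algebra.Properties.Semiring.Sum ℕ.+-*-semiring
  using (sum-syntax; sum-replicate-zero; sum-cong-≗; ∑-distrib-+; ∑-comm; *-distribˡ-sum; *-distribʳ-sum)
open import Data.Product using (∃; _×_; _,_; proj₁; proj₂)
open import Data.Sum using (_⊎_; inj₁; inj₂)
import Data.Sum as Sum
open import Data.Vec using (_∷_; there; lookup; tabulate)
open import Data.Vec.Properties using (lookup-zipWith; lookup-replicate; lookup∘tabulate; lookup⇒[]=; []=⇒lookup)
open import Effect.Monad using (RawMonad)
open import Function using (_∘_)
open import Function.Bundles using (_⇔_; mk⇔; Equivalence)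
open import Relation.Binary.PropositionalEquality
open import Relation.Nullary using (¬_; Dec; yes; no; contradiction)
open import Relation.Nullary.Decidable using (⌊_⌋; isYes≗does; dec-true; dec-false; does-⇔; ¬¬-excluded-middle)
open import Relation.Nullary.Negation using (¬¬-Monad)

open import Defs

isYes-true : ∀ {P : Set} (P? : Dec P) → P → ⌊ P? ⌋ ≡ true
isYes-true P? p = trans (isYes≗does P?) (dec-true P? p)

isYes-false : ∀ {P : Set} (P? : Dec P) → ¬ P → ⌊ P? ⌋ ≡ false
isYes-false P? ¬p = trans (isYes≗does P?) (dec-false P? ¬p)

isYes≡true⇒ : ∀ {P : Set} (P? : Dec P) → ⌊ P? ⌋ ≡ true → P
isYes≡true⇒ (yes p) _ = p

isYes≡false⇒¬ : ∀ {P : Set} (P? : Dec P) → ⌊ P? ⌋ ≡ false → ¬ P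
isYes≡false⇒¬ (no ¬p) _ = ¬p

isYes-⇔ : ∀ {P R : Set} → P ⇔ R → (P? : Dec P) (R? : Dec R) → ⌊ P? ⌋ ≡ ⌊ R? ⌋
isYes-⇔ P⇔R P? R? = trans (isYes≗does P?) (trans (does-⇔ P⇔R P? R?) (sym (isYes≗does R?)))

¬¬-decidable : ∀ {k} (P : Fin k → Set) → ¬ ¬ (∀ i → Dec (P i))
¬¬-decidable P = sequence (RawMonad.rawApplicative ¬¬-Monad) (λ i → ¬¬-excluded-middle)

∧≡true : ∀ {a b} → a ∧ b ≡ true → a ≡ true × b ≡ true
∧≡true {true} {true} _ = refl , refl

xor≡true : ∀ {a b} → a xor b ≡ true → a ≡ true ⊎ b ≡ true
xor≡true {true}  _      = inj₁ refl
xor≡true {false} b≡true = inj₂ b≡true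

m+n≡2⇒m≡1 : ∀ {m n} → m + n ≡ 2 → 1 ≤ m → 1 ≤ n → m ≡ 1
m+n≡2⇒m≡1 {1}           _   _ _ = refl
m+n≡2⇒m≡1 {suc (suc m)} {suc n} m+n≡2 _ _ =
  contradiction (ℕ.suc-injective (ℕ.suc-injective m+n≡2)) (ℕ.m+1+n≢0 m)

⟦_⟧ : Bool → ℕ
⟦ b ⟧ = if b then 1 else 0

⟦⟧≤1 : ∀ b → ⟦ b ⟧ ≤ 1
⟦⟧≤1 true  = s≤s z≤n
⟦⟧≤1 false = z≤n

⟦∧⟧ : ∀ a b → ⟦ a ∧ b ⟧ ≡ ⟦ a ⟧ * ⟦ b ⟧
⟦∧⟧ true  b = sym (+-identityʳ ⟦ b ⟧)
⟦∧⟧ false b = refl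

⟦∧⟧+⟦∧⟧ : ∀ c a b → ⟦ c ∧ a ⟧ + ⟦ c ∧ b ⟧ ≡ 2 * ⟦ c ∧ (a ∧ b) ⟧ + ⟦ c ∧ (a xor b) ⟧
⟦∧⟧+⟦∧⟧ false a     b     = refl
⟦∧⟧+⟦∧⟧ true  true  true  = refl
⟦∧⟧+⟦∧⟧ true  true  false = refl
⟦∧⟧+⟦∧⟧ true  false true  = refl
⟦∧⟧+⟦∧⟧ true  false false = refl

∑-supported : ∀ {n} (f : Fin n → ℕ) x → (∀ v → v ≢ x → f v ≡ 0) → ∑[ v < n ] f v ≡ f x
∑-supported {suc n} f zero f≡0 = begin
  f zero + ∑[ v < n ] f (suc v)  ≡⟨ cong (f zero +_) (sum-cong-≗ (λ v → f≡0 (suc v) λ ())) ⟩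
  f zero + ∑[ v < n ] 0          ≡⟨ cong (f zero +_) (sum-replicate-zero n) ⟩
  f zero + 0                     ≡⟨ +-identityʳ (f zero) ⟩
  f zero                         ∎
  where open ≡-Reasoning
∑-supported {suc n} f (suc x) f≡0 =
  trans (cong (_+ ∑[ v < n ] f (suc v)) (f≡0 zero λ ()))
        (∑-supported (λ v → f (suc v)) x λ v v≢x → f≡0 (suc v) (v≢x ∘ suc-injective))

∑-δ : ∀ {n} (x : Fin n) (g : Fin n → ℕ) → ∑[ v < n ] (⟦ ⌊ x ≟ v ⌋ ⟧ * g v) ≡ g x
∑-δ x g = trans
  (∑-supported (λ v → ⟦ ⌊ x ≟ v ⌋ ⟧ * g v) x λ v v≢x →
     cong (λ b → ⟦ b ⟧ * g v) (isYes-false (x ≟ v) (v≢x ∘ sym)))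
  (trans (cong (λ b → ⟦ b ⟧ * g x) (isYes-true (x ≟ x) refl)) (+-identityʳ (g x)))

∑-fibrewise : ∀ {m n} (p : Fin m → Fin n) (w : Fin m → ℕ) (g : Fin n → ℕ) →
  ∑[ v < n ] (∑[ e < m ] (w e * ⟦ ⌊ p e ≟ v ⌋ ⟧) * g v) ≡ ∑[ e < m ] (w e * g (p e))
∑-fibrewise {m} {n} p w g = begin
  ∑[ v < n ] (∑[ e < m ] (w e * δ e v) * g v)
    ≡⟨ sum-cong-≗ (λ v → *-distribʳ-sum (g v) (λ e → w e * δ e v)) ⟩
  ∑[ v < n ] ∑[ e < m ] (w e * δ e v * g v)
    ≡⟨ ∑-comm (λ v e → w e * δ e v * g v) ⟩
  ∑[ e < m ] ∑[ v < n ] (w e * δ e v * g v)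
    ≡⟨ sum-cong-≗ (λ e → sum-cong-≗ (λ v → *-assoc (w e) (δ e v) (g v))) ⟩
  ∑[ e < m ] ∑[ v < n ] (w e * (δ e v * g v))
    ≡⟨ sum-cong-≗ (λ e → *-distribˡ-sum (w e) (λ v → δ e v * g v)) ⟨
  ∑[ e < m ] (w e * ∑[ v < n ] (δ e v * g v))
    ≡⟨ sum-cong-≗ (λ e → cong (w e *_) (∑-δ (p e) g)) ⟩
  ∑[ e < m ] (w e * g (p e))
    ∎
  where
  open ≡-Reasoning
  δ : Fin m → Fin n → ℕ
  δ e v = ⟦ ⌊ p e ≟ v ⌋ ⟧

∣-∑ : ∀ {d k} (f : Fin k → ℕ) → (∀ i → d ∣ f i) → d ∣ ∑[ i < k ] f i
∣-∑ {d} {zero}  f d∣f = d ∣0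
∣-∑ {d} {suc k} f d∣f = ∣m∣n⇒∣m+n (d∣f zero) (∣-∑ (λ i → f (suc i)) (λ i → d∣f (suc i)))

lookup-⁅⁆ : ∀ {k} (x y : Fin k) → lookup ⁅ y ⁆ x ≡ ⌊ x ≟ y ⌋
lookup-⁅⁆ x y with x ≟ y
... | yes refl = []=⇒lookup (x∈⁅x⁆ x)
... | no x≢y with lookup ⁅ y ⁆ x in x∈?
...   | true  = ⊥-elim (x≢y (x∈⁅y⁆⇒x≡y y (lookup⇒[]= x ⁅ y ⁆ x∈?)))
...   | false = refl

lookup-∪⁅⁆ : ∀ {k} (Q : Subset k) (x y : Fin k) → lookup (Q ∪ ⁅ y ⁆) x ≡ lookup Q x ∨ ⌊ x ≟ y ⌋
lookup-∪⁅⁆ Q x y = trans (lookup-zipWith _∨_ x Q ⁅ y ⁆) (cong (lookup Q x ∨_) (lookup-⁅⁆ x y))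

∈⁅⁆∪⁅⁆ˡ : ∀ {k} {x y : Fin k} → x ∈ ⁅ x ⁆ ∪ ⁅ y ⁆
∈⁅⁆∪⁅⁆ˡ {x = x} = x∈p∪q⁺ (inj₁ (x∈⁅x⁆ x))

∈⁅⁆∪⁅⁆ʳ : ∀ {k} {x y : Fin k} → y ∈ ⁅ x ⁆ ∪ ⁅ y ⁆
∈⁅⁆∪⁅⁆ʳ {y = y} = x∈p∪q⁺ (inj₂ (x∈⁅x⁆ y))

∈⁅⁆∪⁅⁆⇒ : ∀ {k} {x y z : Fin k} → z ∈ ⁅ x ⁆ ∪ ⁅ y ⁆ → z ≡ x ⊎ z ≡ y
∈⁅⁆∪⁅⁆⇒ {x = x} {y} = Sum.map (x∈⁅y⁆⇒x≡y x) (x∈⁅y⁆⇒x≡y y) ∘ x∈p∪q⁻ ⁅ x ⁆ ⁅ y ⁆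

x∉p─p : ∀ {k} (p : Subset k) {x} → x ∉ p ─ p
x∉p─p (true  ∷ p) (there x∈p─p) = x∉p─p p x∈p─p
x∉p─p (false ∷ p) (there x∈p─p) = x∉p─p p x∈p─p

-- For an edge of a loopless graph: qᵢ says that its i-th end lies in Q, bᵢ that it is b.
crossings-∪⁅⁆ : ∀ q₁ q₂ b₁ b₂ → ¬ (b₁ ≡ true × b₂ ≡ true) →
  (b₁ ≡ true → q₁ ≡ false) → (b₂ ≡ true → q₂ ≡ false) → (b₁ ≡ false → b₂ ≡ false → q₁ ≡ q₂) →
  ⟦ q₁ xor q₂ ⟧ + ⟦ (q₁ ∨ b₁) xor (q₂ ∨ b₂) ⟧ ≡ ⟦ b₁ ⟧ + ⟦ b₂ ⟧
crossings-∪⁅⁆ _     _     true  true  ¬b₁∧b₂ _ _ _ = ⊥-elim (¬b₁∧b₂ (refl , refl))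
crossings-∪⁅⁆ true  _     true  false _ b₁⇒¬q₁ _ _ = contradiction (b₁⇒¬q₁ refl) λ ()
crossings-∪⁅⁆ false true  true  false _ _ _ _ = refl
crossings-∪⁅⁆ false false true  false _ _ _ _ = refl
crossings-∪⁅⁆ _     true  false true  _ _ b₂⇒¬q₂ _ = contradiction (b₂⇒¬q₂ refl) λ ()
crossings-∪⁅⁆ true  false false true  _ _ _ _ = refl
crossings-∪⁅⁆ false false false true  _ _ _ _ = refl
crossings-∪⁅⁆ q₁    q₂    false false _ _ _ q₁≡q₂
  rewrite q₁≡q₂ refl refl | ∨-identityʳ q₂ | xor-same q₂ = refl

module _ {n m : ℕ} (ends : Ends n m) where

  end₁ end₂ : Fin m → Fin n
  end₁ e = proj₁ (ends e)
  end₂ e = proj₂ (ends e)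

  countTrue≡∑ : ∀ {k} (f : Fin k → Bool) → countTrue ends f ≡ ∑[ i < k ] ⟦ f i ⟧
  countTrue≡∑ {zero}  f = refl
  countTrue≡∑ {suc k} f = cong (⟦ f zero ⟧ +_) (countTrue≡∑ (λ i → f (suc i)))

  countTrue-+ : ∀ {k} (f g : Fin k → Bool) →
    countTrue ends f + countTrue ends g ≡ ∑[ i < k ] (⟦ f i ⟧ + ⟦ g i ⟧)
  countTrue-+ f g = trans (cong₂ _+_ (countTrue≡∑ f) (countTrue≡∑ g)) (sym (∑-distrib-+ (⟦_⟧ ∘ f) (⟦_⟧ ∘ g)))

  countTrue-pos : ∀ {k} (f : Fin k → Bool) i → f i ≡ true → 1 ≤ countTrue ends f
  countTrue-pos f zero    fi≡true rewrite fi≡true = s≤s z≤n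
  countTrue-pos f (suc i) fi≡true =
    ≤-trans (countTrue-pos (λ i → f (suc i)) i fi≡true) (m≤n+m _ ⟦ f zero ⟧)

  countTrue≡0⊎witness : ∀ {k} (f : Fin k → Bool) → countTrue ends f ≡ 0 ⊎ ∃ λ i → f i ≡ true
  countTrue≡0⊎witness {zero}  f = inj₁ refl
  countTrue≡0⊎witness {suc k} f with f zero in f0 | countTrue≡0⊎witness (λ i → f (suc i))
  ... | true  | _              = inj₂ (zero , f0)
  ... | false | inj₁ count≡0   = inj₁ count≡0
  ... | false | inj₂ (i , fi)  = inj₂ (suc i , fi)

  countTrue-witness : ∀ {k} (f : Fin k → Bool) → 1 ≤ countTrue ends f → ∃ λ i → f i ≡ true
  countTrue-witness f 1≤count with countTrue≡0⊎witness f
  ... | inj₁ count≡0 = contradiction (subst (1 ≤_) count≡0 1≤count) λ ()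
  ... | inj₂ witness = witness

  countTrue-zero : ∀ {k} (f : Fin k → Bool) → (∀ i → f i ≡ false) → countTrue ends f ≡ 0
  countTrue-zero {zero}  f f≡false = refl
  countTrue-zero {suc k} f f≡false rewrite f≡false zero =
    countTrue-zero (λ i → f (suc i)) (λ i → f≡false (suc i))

  countTrue-≤1 : ∀ {k} (f : Fin k → Bool) j → (∀ i → i ≢ j → f i ≡ false) → countTrue ends f ≤ 1
  countTrue-≤1 f j f≡false = subst (_≤ 1) (sym count≡fj) (⟦⟧≤1 (f j))
    where
    count≡fj : countTrue ends f ≡ ⟦ f j ⟧
    count≡fj = trans (countTrue≡∑ f) (∑-supported (⟦_⟧ ∘ f) j (λ i i≢j → cong ⟦_⟧ (f≡false i i≢j)))

  countTrue-mono : ∀ {k} (f g : Fin k → Bool) → (∀ i → f i ≡ true → g i ≡ true) →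
    countTrue ends f ≤ countTrue ends g
  countTrue-mono {zero}  f g f⇒g = z≤n
  countTrue-mono {suc k} f g f⇒g
    with f zero in f0 | countTrue-mono (λ i → f (suc i)) (λ i → g (suc i)) (λ i → f⇒g (suc i))
  ... | true  | tail-mono rewrite f⇒g zero f0 = s≤s tail-mono
  ... | false | tail-mono = ≤-trans tail-mono (m≤n+m _ ⟦ g zero ⟧)

  -- Cuts

  Joins⇒crosses : ∀ (X : Subset n) e {x y} → Joins ends e x y →
    lookup X x ≡ true → lookup X y ≡ false → crosses ends X e ≡ true
  Joins⇒crosses X e (inj₁ ends≡xy) Xx Xy rewrite ends≡xy | Xx | Xy = refl
  Joins⇒crosses X e (inj₂ ends≡yx) Xx Xy rewrite ends≡yx | Xx | Xy = refl

  Joins⇒≢ : Loopless ends → ∀ {e x y} → Joins ends e x y → x ≢ y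
  Joins⇒≢ loopless {e} (inj₁ refl) x≡y = loopless e x≡y
  Joins⇒≢ loopless {e} (inj₂ refl) y≡x = loopless e (sym y≡x)

  Joins⇒ends∈ : ∀ {e x y} → Joins ends e x y → end₁ e ∈ ⁅ x ⁆ ∪ ⁅ y ⁆ × end₂ e ∈ ⁅ x ⁆ ∪ ⁅ y ⁆
  Joins⇒ends∈ {e} (inj₁ refl) = ∈⁅⁆∪⁅⁆ˡ , ∈⁅⁆∪⁅⁆ʳ
  Joins⇒ends∈ {e} (inj₂ refl) = ∈⁅⁆∪⁅⁆ʳ , ∈⁅⁆∪⁅⁆ˡ

  crosses-⁅⁆⇒IncidentTo : ∀ {v e} → crosses ends ⁅ v ⁆ e ≡ true → IncidentTo ends e v
  crosses-⁅⁆⇒IncidentTo {v} {e} crosses≡true =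
    Sum.map (isYes≡true⇒ (end₁ e ≟ v)) (isYes≡true⇒ (end₂ e ≟ v))
      (xor≡true (trans (sym (cong₂ _xor_ (lookup-⁅⁆ (end₁ e) v) (lookup-⁅⁆ (end₂ e) v))) crosses≡true))

  Walk⇒crossing : ∀ {S} (X : Subset n) {x z} → Walk ends S x z →
    lookup X x ≡ true → lookup X z ≡ false → ∃ λ e → crosses ends X e ≡ true
  Walk⇒crossing X stop Xx Xz = contradiction (trans (sym Xx) Xz) λ ()
  Walk⇒crossing X (step {y = y} e _ joins walk) Xx Xz with lookup X y in Xy
  ... | true  = Walk⇒crossing X walk Xy Xz
  ... | false = e , Joins⇒crosses X e joins Xx Xy

  Walk-empty : ∀ {S x y} → (∀ e → e ∉ S) → Walk ends S x y → x ≡ y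
  Walk-empty S-empty stop                = refl
  Walk-empty S-empty (step e e∈S _ _)    = contradiction e∈S (S-empty e)

  visits-start : ∀ {S x z} (walk : Walk ends S x z) → visits ends walk x
  visits-start stop             = refl
  visits-start (step _ _ _ _)   = inj₁ refl

  Connected⇒1≤cutSize : Connected ends → ∀ (X : Subset n) {x y} →
    lookup X x ≡ true → lookup X y ≡ false → 1 ≤ cutSize ends X
  Connected⇒1≤cutSize connected X {x} {y} Xx Xy =
    let e , crosses≡true = Walk⇒crossing X (connected x y) Xx Xy
    in  countTrue-pos (crosses ends X) e crosses≡true

  cutSize+cutSize-∪⁅⁆ : Loopless ends → (Q : Subset n) (b : Fin n) → lookup Q b ≡ false →
    (∀ e → end₁ e ≢ b → end₂ e ≢ b → lookup Q (end₁ e) ≡ lookup Q (end₂ e)) →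
    cutSize ends Q + cutSize ends (Q ∪ ⁅ b ⁆) ≡ deg ends b
  cutSize+cutSize-∪⁅⁆ loopless Q b b∉Q closed = begin
    cutSize ends Q + cutSize ends (Q ∪ ⁅ b ⁆)
      ≡⟨ countTrue-+ (crosses ends Q) (crosses ends (Q ∪ ⁅ b ⁆)) ⟩
    ∑[ e < m ] (⟦ crosses ends Q e ⟧ + ⟦ crosses ends (Q ∪ ⁅ b ⁆) e ⟧)
      ≡⟨ sum-cong-≗ atEdge ⟩
    ∑[ e < m ] (⟦ atB end₁ e ⟧ + ⟦ atB end₂ e ⟧)
      ≡⟨ countTrue-+ (atB end₁) (atB end₂) ⟨
    deg ends b ∎
    where
    open ≡-Reasoning
    atB : (Fin m → Fin n) → Fin m → Bool
    atB end e = lookup (allEdges ends) e ∧ ⌊ end e ≟ b ⌋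
    is-b : ∀ {x} → ⌊ x ≟ b ⌋ ≡ true → x ≡ b
    is-b {x} = isYes≡true⇒ (x ≟ b)
    atEdge : ∀ e → ⟦ crosses ends Q e ⟧ + ⟦ crosses ends (Q ∪ ⁅ b ⁆) e ⟧ ≡ ⟦ atB end₁ e ⟧ + ⟦ atB end₂ e ⟧
    atEdge e
      rewrite lookup-∪⁅⁆ Q (end₁ e) b | lookup-∪⁅⁆ Q (end₂ e) b
            | lookup∘tabulate (λ _ → true) e
            = crossings-∪⁅⁆ (lookup Q (end₁ e)) (lookup Q (end₂ e)) ⌊ end₁ e ≟ b ⌋ ⌊ end₂ e ≟ b ⌋
                (λ (at₁ , at₂) → loopless e (trans (is-b at₁) (sym (is-b at₂))))
                (λ at₁ → subst (λ x → lookup Q x ≡ false) (sym (is-b at₁)) b∉Q)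
                (λ at₂ → subst (λ x → lookup Q x ≡ false) (sym (is-b at₂)) b∉Q)
                (λ ¬at₁ ¬at₂ → closed e (isYes≡false⇒¬ (end₁ e ≟ b) ¬at₁) (isYes≡false⇒¬ (end₂ e ≟ b) ¬at₂))

  cutSize-⁅⁆ : Loopless ends → ∀ b → cutSize ends ⁅ b ⁆ ≡ deg ends b
  cutSize-⁅⁆ loopless b = begin
    cutSize ends ⁅ b ⁆                ≡⟨ cong (cutSize ends) (∪-identityˡ ⁅ b ⁆) ⟨
    cutSize ends (∅ ∪ ⁅ b ⁆)          ≡⟨ cong (_+ cutSize ends (∅ ∪ ⁅ b ⁆)) cutSize-∅ ⟨
    cutSize ends ∅ + cutSize ends (∅ ∪ ⁅ b ⁆)
      ≡⟨ cutSize+cutSize-∪⁅⁆ loopless ∅ b (lookup-replicate b false)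
                              (λ e _ _ → lookup-∅≡lookup-∅ (end₁ e) (end₂ e)) ⟩
    deg ends b                        ∎
    where
    open ≡-Reasoning
    cutSize-∅ : cutSize ends ∅ ≡ 0
    cutSize-∅ = countTrue-zero (crosses ends ∅) λ e →
      cong₂ _xor_ (lookup-replicate (end₁ e) false) (lookup-replicate (end₂ e) false)
    lookup-∅≡lookup-∅ : ∀ x y → lookup (∅ {n}) x ≡ lookup ∅ y
    lookup-∅≡lookup-∅ x y = trans (lookup-replicate x false) (sym (lookup-replicate y false))

  -- Parity of crossings

  ∑-countEndAt≡countEndIn : (C : Subset m) (Q : Subset n) (end : Fin m → Fin n) →
    ∑[ v < n ] (countTrue ends (λ e → lookup C e ∧ ⌊ end e ≟ v ⌋) * ⟦ lookup Q v ⟧)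
      ≡ countTrue ends (λ e → lookup C e ∧ lookup Q (end e))
  ∑-countEndAt≡countEndIn C Q end = begin
    ∑[ v < n ] (countTrue ends (λ e → lookup C e ∧ ⌊ end e ≟ v ⌋) * ⟦ lookup Q v ⟧)
      ≡⟨ sum-cong-≗ (λ v → cong (_* ⟦ lookup Q v ⟧) (countTrue-∧ (λ e → ⌊ end e ≟ v ⌋))) ⟩
    ∑[ v < n ] (∑[ e < m ] (⟦ lookup C e ⟧ * ⟦ ⌊ end e ≟ v ⌋ ⟧) * ⟦ lookup Q v ⟧)
      ≡⟨ ∑-fibrewise end (⟦_⟧ ∘ lookup C) (⟦_⟧ ∘ lookup Q) ⟩
    ∑[ e < m ] (⟦ lookup C e ⟧ * ⟦ lookup Q (end e) ⟧)
      ≡⟨ countTrue-∧ (lookup Q ∘ end) ⟨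
    countTrue ends (λ e → lookup C e ∧ lookup Q (end e)) ∎
    where
    open ≡-Reasoning
    countTrue-∧ : (f : Fin m → Bool) →
      countTrue ends (λ e → lookup C e ∧ f e) ≡ ∑[ e < m ] (⟦ lookup C e ⟧ * ⟦ f e ⟧)
    countTrue-∧ f =
      trans (countTrue≡∑ (λ e → lookup C e ∧ f e)) (sum-cong-≗ (λ e → ⟦∧⟧ (lookup C e) (f e)))

  ∑-degIn≡2*inner+crossing : (C : Subset m) (Q : Subset n) →
    ∑[ v < n ] (degIn ends C v * ⟦ lookup Q v ⟧)
      ≡ 2 * countTrue ends (λ e → lookup C e ∧ (lookup Q (end₁ e) ∧ lookup Q (end₂ e)))
        + countTrue ends (λ e → lookup C e ∧ crosses ends Q e)
  ∑-degIn≡2*inner+crossing C Q = begin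
    ∑[ v < n ] (degIn ends C v * q v)
      ≡⟨ sum-cong-≗ (λ v → *-distribʳ-+ (q v) (atEnd end₁ v) (atEnd end₂ v)) ⟩
    ∑[ v < n ] (atEnd end₁ v * q v + atEnd end₂ v * q v)
      ≡⟨ ∑-distrib-+ (λ v → atEnd end₁ v * q v) (λ v → atEnd end₂ v * q v) ⟩
    ∑[ v < n ] (atEnd end₁ v * q v) + ∑[ v < n ] (atEnd end₂ v * q v)
      ≡⟨ cong₂ _+_ (∑-countEndAt≡countEndIn C Q end₁) (∑-countEndAt≡countEndIn C Q end₂) ⟩
    countTrue ends (λ e → lookup C e ∧ Q₁ e) + countTrue ends (λ e → lookup C e ∧ Q₂ e)
      ≡⟨ countTrue-+ (λ e → lookup C e ∧ Q₁ e) (λ e → lookup C e ∧ Q₂ e) ⟩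
    ∑[ e < m ] (⟦ lookup C e ∧ Q₁ e ⟧ + ⟦ lookup C e ∧ Q₂ e ⟧)
      ≡⟨ sum-cong-≗ (λ e → ⟦∧⟧+⟦∧⟧ (lookup C e) (Q₁ e) (Q₂ e)) ⟩
    ∑[ e < m ] (2 * inner e + crossing e)
      ≡⟨ ∑-distrib-+ (λ e → 2 * inner e) crossing ⟩
    ∑[ e < m ] (2 * inner e) + ∑[ e < m ] crossing e
      ≡⟨ cong (_+ ∑[ e < m ] crossing e) (*-distribˡ-sum 2 inner) ⟨
    2 * ∑[ e < m ] inner e + ∑[ e < m ] crossing e
      ≡⟨ cong₂ (λ i c → 2 * i + c) (countTrue≡∑ (λ e → lookup C e ∧ (Q₁ e ∧ Q₂ e)))
                                    (countTrue≡∑ (λ e → lookup C e ∧ crosses ends Q e)) ⟨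
    2 * countTrue ends (λ e → lookup C e ∧ (Q₁ e ∧ Q₂ e))
      + countTrue ends (λ e → lookup C e ∧ crosses ends Q e) ∎
    where
    open ≡-Reasoning
    q : Fin n → ℕ
    q v = ⟦ lookup Q v ⟧
    atEnd : (Fin m → Fin n) → Fin n → ℕ
    atEnd end v = countTrue ends (λ e → lookup C e ∧ ⌊ end e ≟ v ⌋)
    Q₁ Q₂ : Fin m → Bool
    Q₁ e = lookup Q (end₁ e)
    Q₂ e = lookup Q (end₂ e)
    inner crossing : Fin m → ℕ
    inner e = ⟦ lookup C e ∧ (Q₁ e ∧ Q₂ e) ⟧
    crossing e = ⟦ lookup C e ∧ crosses ends Q e ⟧

  even-degIn⇒even-crossings : (C : Subset m) (Q : Subset n) → (∀ v → 2 ∣ degIn ends C v) →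
    2 ∣ countTrue ends (λ e → lookup C e ∧ crosses ends Q e)
  even-degIn⇒even-crossings C Q 2∣degIn =
    ∣m+n∣m⇒∣n (subst (2 ∣_) (∑-degIn≡2*inner+crossing C Q) 2∣∑)
              (m∣m*n (countTrue ends (λ e → lookup C e ∧ (lookup Q (end₁ e) ∧ lookup Q (end₂ e)))))
    where
    2∣∑ : 2 ∣ ∑[ v < n ] (degIn ends C v * ⟦ lookup Q v ⟧)
    2∣∑ = ∣-∑ (λ v → degIn ends C v * ⟦ lookup Q v ⟧) (λ v → ∣m⇒∣m*n _ (2∣degIn v))

  Touches⊎degIn≡0 : ∀ C v → Touches ends C v ⊎ degIn ends C v ≡ 0
  Touches⊎degIn≡0 C v = touches⊎zero (countTrue≡0⊎witness (at end₁)) (countTrue≡0⊎witness (at end₂))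
    where
    at : (Fin m → Fin n) → Fin m → Bool
    at end e = lookup C e ∧ ⌊ end e ≟ v ⌋
    touch : ∀ {end} → (∀ {e} → end e ≡ v → IncidentTo ends e v) →
            (∃ λ e → at end e ≡ true) → Touches ends C v
    touch {end} incident (e , at≡true) =
      let C∋e , end≡v = ∧≡true at≡true
      in  e , lookup⇒[]= e C C∋e , incident (isYes≡true⇒ (end e ≟ v) end≡v)
    touches⊎zero : countTrue ends (at end₁) ≡ 0 ⊎ ∃ (λ e → at end₁ e ≡ true) →
                   countTrue ends (at end₂) ≡ 0 ⊎ ∃ (λ e → at end₂ e ≡ true) →
                   Touches ends C v ⊎ degIn ends C v ≡ 0
    touches⊎zero (inj₂ at₁)    _              = inj₁ (touch inj₁ at₁)
    touches⊎zero (inj₁ _)      (inj₂ at₂)     = inj₁ (touch inj₂ at₂)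
    touches⊎zero (inj₁ none₁)  (inj₁ none₂)   = inj₂ (cong₂ _+_ none₁ none₂)

  IsCycle⇒2∣degIn : ∀ {C} → IsCycle ends C → ∀ v → 2 ∣ degIn ends C v
  IsCycle⇒2∣degIn {C} (_ , _ , degIn≡2) v with Touches⊎degIn≡0 C v
  ... | inj₁ touches = ∣-reflexive (sym (degIn≡2 v touches))
  ... | inj₂ degIn≡0 = subst (2 ∣_) (sym degIn≡0) (2 ∣0)

  IsCycle⇒crossings≢1 : ∀ {C} → IsCycle ends C → ∀ Q →
    countTrue ends (λ e → lookup C e ∧ crosses ends Q e) ≢ 1
  IsCycle⇒crossings≢1 {C} cycle Q crossings≡1 = contradiction (∣1⇒≡1 2∣1) λ ()
    where
    2∣1 : 2 ∣ 1
    2∣1 = subst (2 ∣_) crossings≡1 (even-degIn⇒even-crossings C Q (IsCycle⇒2∣degIn cycle))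

  -- A single edge crosses the cut around one of its ends once, a cycle evenly often.
  ⊆⁅⁆⇒¬IsCycle : Loopless ends → ∀ {C e} → C ⊆ ⁅ e ⁆ → ¬ IsCycle ends C
  ⊆⁅⁆⇒¬IsCycle loopless {C} {e} C⊆⁅e⁆ cycle@((f , C∋f) , _) with x∈⁅y⁆⇒x≡y e (C⊆⁅e⁆ C∋f)
  ... | refl = IsCycle⇒crossings≢1 cycle ⁅ end₁ f ⁆ (≤-antisym
        (countTrue-≤1 _ f (λ g g≢f → cong (_∧ crosses ends ⁅ end₁ f ⁆ g) (C∌ g g≢f)))
        (countTrue-pos _ f (cong₂ _∧_ ([]=⇒lookup C∋f) f-crosses)))
    where
    C∌ : ∀ g → g ≢ f → lookup C g ≡ false
    C∌ g g≢f with lookup C g in C∋g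
    ... | true  = contradiction (x∈⁅y⁆⇒x≡y f (C⊆⁅e⁆ (lookup⇒[]= g C C∋g))) g≢f
    ... | false = refl
    f-crosses : crosses ends ⁅ end₁ f ⁆ f ≡ true
    f-crosses = Joins⇒crosses ⁅ end₁ f ⁆ f (inj₁ refl)
      (trans (lookup-⁅⁆ (end₁ f) (end₁ f)) (isYes-true (end₁ f ≟ end₁ f) refl))
      (trans (lookup-⁅⁆ (end₂ f) (end₁ f)) (isYes-false (end₂ f ≟ end₁ f) (loopless f ∘ sym)))

  -- Nodes below an external node of a cactus

  IsCactus⇒cutSize≢1 : IsCactus ends → ∀ Q → cutSize ends Q ≢ 1
  IsCactus⇒cutSize≢1 (_ , _ , cycles) Q cut≡1
    with countTrue-witness (crosses ends Q) (≤-reflexive (sym cut≡1))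
  ... | l , l-crosses with proj₁ (cycles l)
  ... | C , cycle , C∋l = IsCycle⇒crossings≢1 cycle Q (≤-antisym
          (≤-trans (countTrue-mono _ (crosses ends Q) (λ e → proj₂ ∘ ∧≡true)) (≤-reflexive cut≡1))
          (countTrue-pos _ l (cong₂ _∧_ ([]=⇒lookup C∋l) l-crosses)))

  data AvoidingWalk (b : Fin n) : Fin n → Fin n → Set where
    stop : ∀ {x} → x ≢ b → AvoidingWalk b x x
    step : ∀ {x y z} e → Joins ends e x y → x ≢ b → AvoidingWalk b y z → AvoidingWalk b x z

  AvoidingWalk⇒¬visits : ∀ {b x z} → AvoidingWalk b x z →
    ∃ λ (walk : Walk ends (allEdges ends) x z) → ¬ visits ends walk b
  AvoidingWalk⇒¬visits (stop x≢b) = stop , x≢b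
  AvoidingWalk⇒¬visits (step e joins x≢b avoiding) =
    let walk , ¬visits = AvoidingWalk⇒¬visits avoiding
    in  step e (lookup⇒[]= e _ (lookup∘tabulate _ e)) joins walk , Sum.[ x≢b , ¬visits ]

  AvoidingWalk⇒≢ : ∀ {b x z} → AvoidingWalk b x z → x ≢ b
  AvoidingWalk⇒≢ (stop x≢b)       = x≢b
  AvoidingWalk⇒≢ (step _ _ x≢b _) = x≢b

  Below-external⇒≡ : IsCactus ends → ∀ {ρ a b} → deg ends b ≡ 2 → b ≢ ρ → Below ends ρ a b → a ≡ b
  Below-external⇒≡ cactus@(connected , loopless , _) {ρ} {a} {b} deg≡2 b≢ρ below with a ≟ b
  ... | yes a≡b = a≡b
  -- Reaching ρ around b is decidable in a finite graph; as the goal is ⊥,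
  -- decidability under double negation is enough.
  ... | no  a≢b = ⊥-elim (¬¬-decidable (λ x → AvoidingWalk b x ρ) reachable-set-is-1-cut)
    where
    reachable-set-is-1-cut : (∀ x → Dec (AvoidingWalk b x ρ)) → ⊥
    reachable-set-is-1-cut reaches? = IsCactus⇒cutSize≢1 cactus Q
      (m+n≡2⇒m≡1 (trans (cutSize+cutSize-∪⁅⁆ loopless Q b Q∌b closed) deg≡2)
                 (Connected⇒1≤cutSize connected Q Q∋ρ Q∌b)
                 (Connected⇒1≤cutSize connected (Q ∪ ⁅ b ⁆) Q∪b∋ρ Q∪b∌a))
      where
      Q : Subset n
      Q = tabulate (λ x → ⌊ reaches? x ⌋)
      Q-lookup : ∀ x → lookup Q x ≡ ⌊ reaches? x ⌋
      Q-lookup = lookup∘tabulate (λ x → ⌊ reaches? x ⌋)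
      Q∌b : lookup Q b ≡ false
      Q∌b = trans (Q-lookup b) (isYes-false (reaches? b) λ b-reaches → AvoidingWalk⇒≢ b-reaches refl)
      Q∋ρ : lookup Q ρ ≡ true
      Q∋ρ = trans (Q-lookup ρ) (isYes-true (reaches? ρ) (stop (b≢ρ ∘ sym)))
      Q∌a : lookup Q a ≡ false
      Q∌a = trans (Q-lookup a) (isYes-false (reaches? a) λ a-reaches →
        let walk , ¬visits = AvoidingWalk⇒¬visits a-reaches in ¬visits (below walk))
      Q∪b∋ρ : lookup (Q ∪ ⁅ b ⁆) ρ ≡ true
      Q∪b∋ρ = trans (lookup-∪⁅⁆ Q ρ b) (cong (_∨ ⌊ ρ ≟ b ⌋) Q∋ρ)
      Q∪b∌a : lookup (Q ∪ ⁅ b ⁆) a ≡ false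
      Q∪b∌a = trans (lookup-∪⁅⁆ Q a b) (cong₂ _∨_ Q∌a (isYes-false (a ≟ b) a≢b))
      closed : ∀ e → end₁ e ≢ b → end₂ e ≢ b → lookup Q (end₁ e) ≡ lookup Q (end₂ e)
      closed e end₁≢b end₂≢b = begin
        lookup Q (end₁ e)        ≡⟨ Q-lookup (end₁ e) ⟩
        ⌊ reaches? (end₁ e) ⌋    ≡⟨ isYes-⇔ (mk⇔ (step e (inj₂ refl) end₂≢b) (step e (inj₁ refl) end₁≢b))
                                            (reaches? (end₁ e)) (reaches? (end₂ e)) ⟩
        ⌊ reaches? (end₂ e) ⌋    ≡⟨ Q-lookup (end₂ e) ⟨
        lookup Q (end₂ e)        ∎
        where open ≡-Reasoning

  -- Hubs of a singleton

  Hub-⁅⁆⇒ : ∀ {K v w} → Hub ends K ⁅ v ⁆ w → w ≡ v ⊎ Adjacent ends v w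
  Hub-⁅⁆⇒ {v = v} {w} ((e , crosses≡true , w-incident) , _) =
    neighbour (crosses-⁅⁆⇒IncidentTo crosses≡true) w-incident
    where
    neighbour : IncidentTo ends e v → IncidentTo ends e w → w ≡ v ⊎ Adjacent ends v w
    neighbour (inj₁ end₁≡v) (inj₁ end₁≡w) = inj₁ (trans (sym end₁≡w) end₁≡v)
    neighbour (inj₁ end₁≡v) (inj₂ end₂≡w) = inj₂ (e , inj₁ (cong₂ _,_ end₁≡v end₂≡w))
    neighbour (inj₂ end₂≡v) (inj₁ end₁≡w) = inj₂ (e , inj₂ (cong₂ _,_ end₁≡w end₂≡v))
    neighbour (inj₂ end₂≡v) (inj₂ end₂≡w) = inj₁ (trans (sym end₂≡w) end₂≡v)

  ∅-SpanningTreeOf-⁅⁆ : ∀ v → SpanningTreeOf ends (⁅ v ⁆ ∪ ⁅ v ⁆) ∅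
  ∅-SpanningTreeOf-⁅⁆ v = (λ e e∈∅ → contradiction e∈∅ ∉⊥) , walk , λ C C⊆∅ ((e , C∋e) , _) → ∉⊥ (C⊆∅ C∋e)
    where
    walk : ∀ x y → x ∈ ⁅ v ⁆ ∪ ⁅ v ⁆ → y ∈ ⁅ v ⁆ ∪ ⁅ v ⁆ → Walk ends ∅ x y
    walk x y x∈ y∈ with ∈⁅⁆∪⁅⁆⇒ x∈ | ∈⁅⁆∪⁅⁆⇒ y∈
    ... | inj₁ refl | inj₁ refl = stop
    ... | inj₁ refl | inj₂ refl = stop
    ... | inj₂ refl | inj₁ refl = stop
    ... | inj₂ refl | inj₂ refl = stop

  Hub-self : ∀ {K v} → K ≥ 1 → cutSize ends ⁅ v ⁆ ≡ K → Hub ends K ⁅ v ⁆ v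
  Hub-self {K} {v} K≥1 cut≡K with countTrue-witness (crosses ends ⁅ v ⁆) (subst (1 ≤_) (sym cut≡K) K≥1)
  ... | e , e-crosses = (e , e-crosses , crosses-⁅⁆⇒IncidentTo e-crosses)
                      , ∅ , ∅-SpanningTreeOf-⁅⁆ v , λ f f∈∅ → contradiction f∈∅ ∉⊥

  Joins⇒⁅⁆-SpanningTreeOf : Loopless ends → ∀ {e v w} → Joins ends e v w →
    SpanningTreeOf ends (⁅ v ⁆ ∪ ⁅ w ⁆) ⁅ e ⁆
  Joins⇒⁅⁆-SpanningTreeOf loopless {e} {v} {w} joins = ends∈ , walk , λ C → ⊆⁅⁆⇒¬IsCycle loopless
    where
    ends∈ : ∀ f → f ∈ ⁅ e ⁆ → end₁ f ∈ ⁅ v ⁆ ∪ ⁅ w ⁆ × end₂ f ∈ ⁅ v ⁆ ∪ ⁅ w ⁆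
    ends∈ f f∈⁅e⁆ with x∈⁅y⁆⇒x≡y e f∈⁅e⁆
    ... | refl = Joins⇒ends∈ joins
    walk : ∀ x y → x ∈ ⁅ v ⁆ ∪ ⁅ w ⁆ → y ∈ ⁅ v ⁆ ∪ ⁅ w ⁆ → Walk ends ⁅ e ⁆ x y
    walk x y x∈ y∈ with ∈⁅⁆∪⁅⁆⇒ x∈ | ∈⁅⁆∪⁅⁆⇒ y∈
    ... | inj₁ refl | inj₁ refl = stop
    ... | inj₁ refl | inj₂ refl = step e (x∈⁅x⁆ e) joins stop
    ... | inj₂ refl | inj₁ refl = step e (x∈⁅x⁆ e) (Sum.swap joins) stop
    ... | inj₂ refl | inj₂ refl = stop

  Joins⇒IsOutSet-⁅⁆ : Loopless ends → ∀ {e v w} → Joins ends e v w →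
    IsOutSet ends (⁅ v ⁆ ∪ ⁅ w ⁆) ⁅ e ⁆ w e ⁅ v ⁆
  Joins⇒IsOutSet-⁅⁆ loopless {e} {v} {w} joins x = mk⇔ to from
    where
    to : x ∈ ⁅ v ⁆ → x ∈ ⁅ v ⁆ ∪ ⁅ w ⁆ × ¬ Walk ends (⁅ e ⁆ - e) w x
    to x∈⁅v⁆ with x∈⁅y⁆⇒x≡y v x∈⁅v⁆
    ... | refl = ∈⁅⁆∪⁅⁆ˡ , λ walk → Joins⇒≢ loopless joins (sym (Walk-empty (λ f → x∉p─p ⁅ e ⁆) walk))
    from : x ∈ ⁅ v ⁆ ∪ ⁅ w ⁆ × ¬ Walk ends (⁅ e ⁆ - e) w x → x ∈ ⁅ v ⁆
    from (x∈ , ¬walk) with ∈⁅⁆∪⁅⁆⇒ x∈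
    ... | inj₁ refl = x∈⁅x⁆ v
    ... | inj₂ refl = contradiction stop ¬walk

  Hub-neighbour : ∀ {K v w} → Loopless ends → cutSize ends ⁅ v ⁆ ≡ K → Adjacent ends v w →
    Hub ends K ⁅ v ⁆ w
  Hub-neighbour {K} {v} {w} loopless cut≡K (e , joins) =
    (e , e-crosses , Sum.[ inj₂ ∘ cong proj₂ , inj₁ ∘ cong proj₁ ]′ joins) ,
    ⁅ e ⁆ , Joins⇒⁅⁆-SpanningTreeOf loopless joins , safe
    where
    e-crosses : crosses ends ⁅ v ⁆ e ≡ true
    e-crosses = Joins⇒crosses ⁅ v ⁆ e joins
      (trans (lookup-⁅⁆ v v) (isYes-true (v ≟ v) refl))
      (trans (lookup-⁅⁆ w v) (isYes-false (w ≟ v) (Joins⇒≢ loopless joins ∘ sym)))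
    safe : Safe ends K (⁅ v ⁆ ∪ ⁅ w ⁆) ⁅ e ⁆ w
    safe f f∈⁅e⁆ with x∈⁅y⁆⇒x≡y e f∈⁅e⁆
    ... | refl = ⁅ v ⁆ , Joins⇒IsOutSet-⁅⁆ loopless joins , cut≡K

  Hub-⁅⁆⇔ : ∀ {K v} → Loopless ends → K ≥ 1 → cutSize ends ⁅ v ⁆ ≡ K →
    ∀ w → Hub ends K ⁅ v ⁆ w ⇔ (w ≡ v ⊎ Adjacent ends v w)
  Hub-⁅⁆⇔ loopless K≥1 cut≡K w =
    mk⇔ Hub-⁅⁆⇒ Sum.[ (λ { refl → Hub-self K≥1 cut≡K }) , Hub-neighbour loopless cut≡K ]′

∈preimage-⁅⁆⇔ : ∀ {n c} (φ : Fin n → Fin c) b x → x ∈ preimage φ ⁅ b ⁆ ⇔ φ x ≡ b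
∈preimage-⁅⁆⇔ φ b x = mk⇔
  (λ x∈ → x∈⁅y⁆⇒x≡y b (lookup⇒[]= (φ x) ⁅ b ⁆ (trans (sym (lookup∘tabulate _ x)) ([]=⇒lookup x∈))))
  (λ { refl → lookup⇒[]= x (preimage φ ⁅ b ⁆) (trans (lookup∘tabulate _ x) ([]=⇒lookup (x∈⁅x⁆ (φ x)))) })

below-external≡⁅⁆ : ∀ {n c l} (links : Ends c l) (φ : Fin n → Fin c) → IsCactus links →
  ∀ {ρ b v} → deg links b ≡ 2 → b ≢ ρ → preimage φ ⁅ b ⁆ ≡ ⁅ v ⁆ →
  (W : Subset n) → (∀ x → x ∈ W ⇔ Below links ρ (φ x) b) → W ≡ ⁅ v ⁆
below-external≡⁅⁆ links φ cactus {ρ} {b} {v} deg≡2 b≢ρ preimage≡⁅v⁆ W W⇔below =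
  ⊆-antisym (λ {x} x∈W → φx≡b⇒x∈⁅v⁆ x (Below-external⇒≡ links cactus deg≡2 b≢ρ
                                          (Equivalence.to (W⇔below x) x∈W)))
            (λ {x} x∈⁅v⁆ → Equivalence.from (W⇔below x) λ walk →
               subst (visits links walk) (x∈⁅v⁆⇒φx≡b x x∈⁅v⁆) (visits-start links walk))
  where
  φx≡b⇒x∈⁅v⁆ : ∀ x → φ x ≡ b → x ∈ ⁅ v ⁆
  φx≡b⇒x∈⁅v⁆ x = subst (x ∈_) preimage≡⁅v⁆ ∘ Equivalence.from (∈preimage-⁅⁆⇔ φ b x)
  x∈⁅v⁆⇒φx≡b : ∀ x → x ∈ ⁅ v ⁆ → φ x ≡ b
  x∈⁅v⁆⇒φx≡b x = Equivalence.to (∈preimage-⁅⁆⇔ φ b x) ∘ subst (x ∈_) (sym preimage≡⁅v⁆)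

mainTheorem9 : ∀ {n m c l : ℕ} (K : ℕ) → K ≥ 1 →
    (ends : Ends n m) → Loopless ends → KEdgeConnected ends K →
    (links : Ends c l) (φ : Fin n → Fin c) → IsCactusRep ends K links φ →
    (∀ (b : Fin c) → ∣ preimage φ ⁅ b ⁆ ∣ ≤ 1) →
    (r : Fin n) → deg ends r ≡ K →
    (b : Fin c) → b ≢ φ r → deg links b ≡ 2 →
    (v : Fin n) → preimage φ ⁅ b ⁆ ≡ ⁅ v ⁆ →
    (W : Subset n) → (∀ x → (x ∈ W) ⇔ Below links (φ r) (φ x) b) →
    ∀ (w : Fin n) → Hub ends K W w ⇔ ((w ≡ v) ⊎ Adjacent ends v w)
mainTheorem9 K K≥1 ends loopless _ links φ (cactus , isRep) _ r _ b b≢φr deg≡2 v preimage≡⁅v⁆ W W⇔below w =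
  subst (λ Z → Hub ends K Z w ⇔ ((w ≡ v) ⊎ Adjacent ends v w)) (sym W≡⁅v⁆)
        (Hub-⁅⁆⇔ ends loopless K≥1 cut⁅v⁆≡K w)
  where
  W≡⁅v⁆ : W ≡ ⁅ v ⁆
  W≡⁅v⁆ = below-external≡⁅⁆ links φ cactus deg≡2 b≢φr preimage≡⁅v⁆ W W⇔below
  cut⁅b⁆≡2 : cutSize links ⁅ b ⁆ ≡ 2
  cut⁅b⁆≡2 = trans (cutSize-⁅⁆ links (proj₁ (proj₂ cactus)) b) deg≡2
  cut⁅v⁆≡K : cutSize ends ⁅ v ⁆ ≡ K
  cut⁅v⁆≡K = Equivalence.from (isRep ⁅ v ⁆) (⁅ b ⁆ , cut⁅b⁆≡2 , sym preimage≡⁅v⁆)
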